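{- Let $k\ge4$ be a power of $2$ and let $\bar b\in\mathbb N^k$ be v-shaped and s-dominating. Then $half\_split^k(\bar b)=split^k(\bar b)$.
   Context: $\bar b=\langle b_1,\dots,b_k\rangle$ is v-shaped if $b_1\ge\dots\ge b_p\le b_{p+1}\le\dots\le b_k$ for some $p$, and s-dominating if $b_j\ge b_{k-j+1}$ for all $1\le j\le k/2$. A comparator $c_{i,j}$ ($i<j$) puts the maximum of the entries at positions $i,j$ into position $i$ and the minimum into position $j$. $split^k$ applies the comparators $c_{i,k/2+i}$ for $i=1,\dots,k/2$; $half\_split^k$ applies only the comparators $c_{i,k/2+i}$ for $i=k/4+1,\dots,k/2$. -}

module Defs where

open import Data.Nat using (ℕ; zero; suc; _+_; _∸_; _*_; _^_; _≤_; _<_; _≥_; _⊔_; _⊓_; _≟_; _/_)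
open import Data.Fin using (Fin; toℕ)
open import Data.List using (List; []; _∷_; foldl; map; upTo)
open import Data.Product using (Σ; _×_; ∃; _,_)
open import Relation.Nullary using (yes; no)

-- A sequence of length k is a function Fin k → ℕ.
-- Positions are 1-based in the paper: Fin index x is position toℕ x + 1.
pos : ∀ {k} → Fin k → ℕ
pos x = suc (toℕ x)

-- Entry at 1-based position i (0 outside 1..k; only used for in-range i).
at : ∀ {k} → (Fin k → ℕ) → ℕ → ℕ
at {zero} b i = 0
at {suc k} b zero = 0
at {suc k} b (suc zero) = b Data.Fin.zero
at {suc k} b (suc (suc i)) = at {k} (λ x → b (Data.Fin.suc x)) (suc i)

comparator : ∀ {k} → ℕ → ℕ → (Fin k → ℕ) → (Fin k → ℕ)
comparator i j b x with pos x ≟ i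
... | yes _ = at b i ⊔ at b j
... | no _ with pos x ≟ j
...   | yes _ = at b i ⊓ at b j
...   | no _ = b x

applyAll : ∀ {k} → List ℕ → (Fin k → ℕ) → (Fin k → ℕ)
applyAll {k} is b = foldl (λ c i → comparator i (k / 2 + i) c) b is

range : ℕ → ℕ → List ℕ
range a b = map (a +_) (upTo (suc b ∸ a))

split : ∀ {k} → (Fin k → ℕ) → (Fin k → ℕ)
split {k} = applyAll (range 1 (k / 2))

half-split : ∀ {k} → (Fin k → ℕ) → (Fin k → ℕ)
half-split {k} = applyAll (range (k / 4 + 1) (k / 2))

VShaped : ∀ {k} → (Fin k → ℕ) → Set
VShaped {k} b = Σ (Fin k) λ p →
    (∀ (x y : Fin k) → toℕ x ≤ toℕ y → toℕ y ≤ toℕ p → b y ≤ b x)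
  × (∀ (x y : Fin k) → toℕ p ≤ toℕ x → toℕ x ≤ toℕ y → b x ≤ b y)

SDominating : ∀ {k} → (Fin k → ℕ) → Set
SDominating {k} b = ∀ (j : ℕ) → 1 ≤ j → 2 * j ≤ k → at b j ≥ at b (k ∸ j + 1)

-- Only the comparators c_{i,k/2+i} with i ≤ k/4 separate split^k from half_split^k,
-- and each of them already finds its pair in order, b_{k/2+i} ≤ b_i, so it acts as
-- the identity. Indeed k/2+i lies in the window [i, k+1-i]; in a v-shaped sequence
-- every entry of a window is bounded by the larger of its two ends, and s-domination
-- makes b_i the larger one.
module Submission where

open import Defs
open import Data.Nat using (ℕ; _^_; _≤_)
open import Data.Fin using (Fin)
open import Relation.Binary.PropositionalEquality using (_≡_)

open import Data.Nat using (zero; suc; _+_; _*_; _∸_; _<_; _⊔_; _⊓_; _≟_; _/_; s≤s; z≤n)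
open import Data.Nat.Properties
open import Data.Nat.DivMod using (m/n*n≤m; m/n≤m; m/n/o≡m/[n*o]; /-monoʳ-≤)
open import Data.Fin using (toℕ; fromℕ<) renaming (zero to fzero; suc to fsuc)
open import Data.Fin.Properties using (toℕ-fromℕ<)
open import Data.List using ([]; _∷_; _++_; map; upTo; applyUpTo)
open import Data.List.Properties using (map-upTo; map-++; map-∘; map-cong; foldl-++)
open import Data.List.Relation.Unary.All using (All; []; _∷_)
open import Data.List.Relation.Unary.All.Properties using (applyUpTo⁺₁)
open import Data.Product using (_,_)
open import Data.Sum using (inj₁; inj₂)
open import Function using (_∘_; id)
open import Relation.Binary.PropositionalEquality
  using (refl; sym; trans; cong; cong₂; subst; subst₂; _≗_; module ≡-Reasoning)
open import Relation.Nullary using (yes; no)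

at-cong : ∀ {k} {b c : Fin k → ℕ} → b ≗ c → ∀ i → at b i ≡ at c i
at-cong {zero}  e i             = refl
at-cong {suc k} e zero          = refl
at-cong {suc k} e (suc zero)    = e fzero
at-cong {suc k} e (suc (suc i)) = at-cong {k} (e ∘ fsuc) (suc i)

at-pos : ∀ {k} (b : Fin k → ℕ) (x : Fin k) → at b (pos x) ≡ b x
at-pos {suc k} b fzero    = refl
at-pos {suc k} b (fsuc x) = at-pos {k} (b ∘ fsuc) x

at-suc : ∀ {k} (b : Fin k → ℕ) {j} (j<k : j < k) → at b (suc j) ≡ b (fromℕ< j<k)
at-suc {suc k} b {zero}  _         = refl
at-suc {suc k} b {suc j} (s≤s j<k) = at-suc {k} (b ∘ fsuc) j<k

vshaped-valley : ∀ {k} {b : Fin k → ℕ} → VShaped b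
               → ∀ x y z → toℕ x ≤ toℕ y → toℕ y ≤ toℕ z → b y ≤ b x ⊔ b z
vshaped-valley {b = b} (p , dec , inc) x y z x≤y y≤z with ≤-total (toℕ y) (toℕ p)
... | inj₁ y≤p = m≤n⇒m≤n⊔o (b z) (dec x y x≤y y≤p)
... | inj₂ p≤y = m≤n⇒m≤o⊔n (b x) (inc y z p≤y y≤z)

vshaped-at-valley : ∀ {k} {b : Fin k → ℕ} → VShaped b
                  → ∀ {i j l} → 1 ≤ i → i ≤ j → j ≤ l → l ≤ k → at b j ≤ at b i ⊔ at b l
vshaped-at-valley {b = b} vs {suc i} {suc j} {suc l} _ (s≤s i≤j) (s≤s j≤l) l<k =
  subst₂ _≤_ (sym (at-suc b j<k)) (sym (cong₂ _⊔_ (at-suc b i<k) (at-suc b l<k)))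
    (vshaped-valley vs (fromℕ< i<k) (fromℕ< j<k) (fromℕ< l<k)
      (subst₂ _≤_ (sym (toℕ-fromℕ< i<k)) (sym (toℕ-fromℕ< j<k)) i≤j)
      (subst₂ _≤_ (sym (toℕ-fromℕ< j<k)) (sym (toℕ-fromℕ< l<k)) j≤l))
  where
  j<k = ≤-trans (s≤s j≤l) l<k
  i<k = ≤-trans (s≤s i≤j) j<k

half+half≤ : ∀ m → m / 2 + m / 2 ≤ m
half+half≤ m = subst (_≤ m) m/2*2≡m/2+m/2 (m/n*n≤m m 2)
  where
  m/2*2≡m/2+m/2 : m / 2 * 2 ≡ m / 2 + m / 2
  m/2*2≡m/2+m/2 = trans (*-comm (m / 2) 2) (cong (m / 2 +_) (+-identityʳ (m / 2)))

vshaped-sdominating-lower-sorted : ∀ {k} {b : Fin k → ℕ} → VShaped b → SDominating b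
                                 → ∀ i → 1 ≤ i → i ≤ k / 4 → at b (k / 2 + i) ≤ at b i
vshaped-sdominating-lower-sorted {k} {b} vs sd i 1≤i i≤q = begin
  at b (h + i)                ≤⟨ vshaped-at-valley vs 1≤i (m≤n+m i h) h+i≤l l≤k ⟩
  at b i ⊔ at b (k ∸ i + 1)   ≡⟨ m≥n⇒m⊔n≡m (sd i 1≤i 2i≤k) ⟩
  at b i                      ∎
  where
  open ≤-Reasoning
  h = k / 2
  q+q≤h : k / 4 + k / 4 ≤ h
  q+q≤h = subst (λ q → q + q ≤ h) (m/n/o≡m/[n*o] k 2 2) (half+half≤ h)
  i+i≤h : i + i ≤ h
  i+i≤h = ≤-trans (+-mono-≤ i≤q i≤q) q+q≤h
  h+i+i≤k : h + i + i ≤ k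
  h+i+i≤k = begin
    h + i + i     ≡⟨ +-assoc h i i ⟩
    h + (i + i)   ≤⟨ +-monoʳ-≤ h i+i≤h ⟩
    h + h         ≤⟨ half+half≤ k ⟩
    k             ∎
  i≤k : i ≤ k
  i≤k = ≤-trans (m≤n+m i (h + i)) h+i+i≤k
  2i≤k : 2 * i ≤ k
  2i≤k = subst (_≤ k) (cong (i +_) (sym (+-identityʳ i))) (≤-trans i+i≤h (m/n≤m k 2))
  h+i≤l : h + i ≤ k ∸ i + 1
  h+i≤l = ≤-trans (m+n≤o⇒m≤o∸n (h + i) h+i+i≤k) (m≤m+n (k ∸ i) 1)
  l≤k : k ∸ i + 1 ≤ k
  l≤k = ≤-trans (+-monoʳ-≤ (k ∸ i) 1≤i) (≤-reflexive (m∸n+n≡m i≤k))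

comparator-cong : ∀ {k} i j {b c : Fin k → ℕ} → b ≗ c → comparator i j b ≗ comparator i j c
comparator-cong i j e x with pos x ≟ i
... | yes _ = cong₂ _⊔_ (at-cong e i) (at-cong e j)
... | no _ with pos x ≟ j
...   | yes _ = cong₂ _⊓_ (at-cong e i) (at-cong e j)
...   | no _  = e x

comparator-sorted : ∀ {k} i j (b : Fin k → ℕ) → at b j ≤ at b i → comparator i j b ≗ b
comparator-sorted i j b j≤i x with pos x ≟ i
... | yes refl = trans (m≥n⇒m⊔n≡m j≤i) (at-pos b x)
... | no _ with pos x ≟ j
...   | yes refl = trans (m≥n⇒m⊓n≡n j≤i) (at-pos b x)
...   | no _     = refl

applyAll-cong : ∀ {k} is {b c : Fin k → ℕ} → b ≗ c → applyAll is b ≗ applyAll is c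
applyAll-cong []       e = e
applyAll-cong (i ∷ is) e = applyAll-cong is (comparator-cong i _ e)

applyAll-sorted : ∀ {k} is (b : Fin k → ℕ) → All (λ i → at b (k / 2 + i) ≤ at b i) is
                → applyAll is b ≗ b
applyAll-sorted []       b []         x = refl
applyAll-sorted (i ∷ is) b (i≤ ∷ is≤) x =
  trans (applyAll-cong is (comparator-sorted i _ b i≤) x) (applyAll-sorted is b is≤ x)

applyUpTo-++ : ∀ (f : ℕ → ℕ) m n → applyUpTo f (m + n) ≡ applyUpTo f m ++ applyUpTo (f ∘ (m +_)) n
applyUpTo-++ f zero    n = refl
applyUpTo-++ f (suc m) n = cong (f 0 ∷_) (applyUpTo-++ (f ∘ suc) m n)

upTo-++ : ∀ m n → upTo (m + n) ≡ upTo m ++ map (m +_) (upTo n)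
upTo-++ m n = trans (applyUpTo-++ id m n) (cong (upTo m ++_) (sym (map-upTo (m +_) n)))

range-++ : ∀ {a b c} → a ≤ suc b → b ≤ c → range a c ≡ range a b ++ range (suc b) c
range-++ {a} {b} {c} a≤1+b b≤c = begin
  map (a +_) (upTo (suc c ∸ a))                             ≡⟨ cong (map (a +_) ∘ upTo) length-split ⟩
  map (a +_) (upTo (m + n))                                 ≡⟨ cong (map (a +_)) (upTo-++ m n) ⟩
  map (a +_) (upTo m ++ map (m +_) (upTo n))                ≡⟨ map-++ (a +_) (upTo m) _ ⟩
  range a b ++ map (a +_) (map (m +_) (upTo n))             ≡⟨ cong (range a b ++_) (sym (map-∘ (upTo n))) ⟩
  range a b ++ map ((a +_) ∘ (m +_)) (upTo n)               ≡⟨ cong (range a b ++_) (map-cong shift (upTo n)) ⟩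
  range a b ++ range (suc b) c                              ∎
  where
  open ≡-Reasoning
  m = suc b ∸ a
  n = c ∸ b
  length-split : suc c ∸ a ≡ m + n
  length-split = begin
    suc c ∸ a        ≡⟨ cong (_∸ a) (sym (m+[n∸m]≡n (s≤s b≤c))) ⟩
    suc b + n ∸ a    ≡⟨ +-∸-comm n a≤1+b ⟩
    m + n            ∎
  shift : ∀ i → a + (m + i) ≡ suc b + i
  shift i = trans (sym (+-assoc a m i)) (cong (_+ i) (m+[n∸m]≡n a≤1+b))

half-split≗split : ∀ {k} (b : Fin k → ℕ)
                 → (∀ i → 1 ≤ i → i ≤ k / 4 → at b (k / 2 + i) ≤ at b i)
                 → half-split b ≗ split b
half-split≗split {k} b sorted x = begin
  applyAll (range (k / 4 + 1) (k / 2)) b x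
    ≡⟨ cong (λ a → applyAll (range a (k / 2)) b x) (+-comm (k / 4) 1) ⟩
  applyAll upper b x
    ≡⟨ applyAll-cong upper (λ y → sym (applyAll-sorted lower b lower-sorted y)) x ⟩
  applyAll upper (applyAll lower b) x
    ≡⟨ cong (λ f → f x) (sym (foldl-++ _ b lower upper)) ⟩
  applyAll (lower ++ upper) b x
    ≡⟨ cong (λ is → applyAll is b x) (sym (range-++ (s≤s z≤n) (/-monoʳ-≤ k (s≤s (s≤s z≤n))))) ⟩
  split b x
    ∎
  where
  open ≡-Reasoning
  lower = range 1 (k / 4)
  upper = range (suc (k / 4)) (k / 2)
  lower-sorted : All (λ i → at b (k / 2 + i) ≤ at b i) lower
  lower-sorted = subst (All _) (sym (map-upTo suc (k / 4)))
    (applyUpTo⁺₁ suc (k / 4) (λ i<q → sorted _ (s≤s z≤n) i<q))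

-- The argument works for every length k.
lemma4 : (n : ℕ) → 2 ≤ n → (b : Fin (2 ^ n) → ℕ) → VShaped b → SDominating b
       → (x : Fin (2 ^ n)) → half-split b x ≡ split b x
lemma4 n _ b vs sd = half-split≗split b (vshaped-sdominating-lower-sorted vs sd)
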